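{- Let $\mathcal{R}$ be a TRS and let $\langle \mathcal{R},\emptyset\rangle = \langle\mathcal{S}_0,\mathcal{P}_0\rangle \leadsto \langle\mathcal{S}_1,\mathcal{P}_1\rangle \leadsto \cdots \leadsto \langle\mathcal{S}_n,\mathcal{P}_n\rangle$ be a derivation of the abstract reduction-preserving completion procedure. If $\mathcal{S}_n\cup\mathcal{P}_n$ is confluent, then $\mathcal{R}$ is confluent.
   Context: A rewrite rule $l\to r$ is a pair of terms with $l$ not a variable and every variable of $r$ occurring in $l$; a TRS is a finite set of rewrite rules, with rewrite relation $\to_{\mathcal{R}}$ (replace an instance $l\sigma$ of a left-hand side at some position by $r\sigma$). A TRS $\mathcal{P}$ is reversible if $s\to_{\mathcal{P}} t$ implies $t\stackrel{*}{\to}_{\mathcal{P}} s$. $\mathcal{R}$ is confluent if ${\stackrel{*}{\gets}}\circ{\stackrel{*}{\to}}\subseteq{\stackrel{*}{\to}}\circ{\stackrel{*}{\gets}}$ for $\to_{\mathcal{R}}$. $\stackrel{*}{\leftrightarrow}_{\mathcal{P}}$ is the equivalence closure of $\to_{\mathcal{P}}$; $\circ$ is relational composition. The abstract reduction-preserving completion procedure acts on pairs $\langle\mathcal{S},\mathcal{P}\rangle$ of TRSs with $\mathcal{P}$ reversible, and a step $\leadsto$ is one of: (Partition) $\langle\mathcal{S},\mathcal{P}\rangle\leadsto\langle\mathcal{S}',\mathcal{P}'\rangle$ if $\mathcal{S}\cup\mathcal{P}=\mathcal{S}'\cup\mathcal{P}'$ and $\mathcal{P}'$ is reversible; (Replacement)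 $\langle\mathcal{S}\cup\{l\to r\},\mathcal{P}\rangle\leadsto\langle\mathcal{S}\cup\{l\to r'\},\mathcal{P}\rangle$ if $r\stackrel{*}{\leftrightarrow}_{\mathcal{P}} r'$ (and $l\to r'$ is a rewrite rule); (Addition) $\langle\mathcal{S},\mathcal{P}\rangle\leadsto\langle\mathcal{S}\cup\{l\to r\},\mathcal{P}\rangle$ if $l \stackrel{*}{\leftrightarrow}_{\mathcal{P}}\circ\stackrel{*}{\to}_{\mathcal{S}} r$ (and $l\to r$ is a rewrite rule). -}

module Defs where

open import Data.Nat using (ℕ)
open import Data.Fin using (Fin)
open import Data.Vec using (Vec; []; _∷_; lookup; _[_]≔_)
open import Data.List using (List; []; _∷_)
open import Data.List.Membership.Propositional using (_∈_)
open import Data.List.Relation.Unary.All using (All)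
open import Data.Product using (_×_; _,_; ∃; ∃-syntax; Σ)
open import Data.Sum using (_⊎_)
open import Data.Empty using (⊥)
open import Relation.Nullary using (¬_)
open import Relation.Binary.PropositionalEquality using (_≡_)
open import Relation.Binary.Construct.Closure.ReflexiveTransitive using (Star)
open import Relation.Binary.Construct.Closure.Equivalence using (EqClosure)
open import Function.Bundles using (_⇔_)

module TRS (F : Set) (ar : F → ℕ) (V : Set) where

  data Term : Set where
    var : V → Term
    fun : (f : F) → Vec Term (ar f) → Term

  mutual
    data _occursIn_ (x : V) : Term → Set where
      here : x occursIn var x
      there : ∀ {f ts} → x occursInAll ts → x occursIn fun f ts

    data _occursInAll_ (x : V) : ∀ {n} → Vec Term n → Set where
      hd : ∀ {n t} {ts : Vec Term n} → x occursIn t → x occursInAll (t ∷ ts)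
      tl : ∀ {n t} {ts : Vec Term n} → x occursInAll ts → x occursInAll (t ∷ ts)

  IsVar : Term → Set
  IsVar t = ∃[ x ] t ≡ var x

  Subst : Set
  Subst = V → Term

  mutual
    _⟨_⟩ : Term → Subst → Term
    var x ⟨ σ ⟩ = σ x
    fun f ts ⟨ σ ⟩ = fun f (ts ⟨ σ ⟩*)

    _⟨_⟩* : ∀ {n} → Vec Term n → Subst → Vec Term n
    [] ⟨ σ ⟩* = []
    (t ∷ ts) ⟨ σ ⟩* = (t ⟨ σ ⟩) ∷ (ts ⟨ σ ⟩*)

  Rule : Set
  Rule = Term × Term

  IsRewriteRule : Rule → Set
  IsRewriteRule (l , r) = ¬ IsVar l × (∀ x → x occursIn r → x occursIn l)

  -- a TRS: finite set of rules, represented as a list (sets up to membership)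
  RuleList : Set
  RuleList = List Rule

  IsTRS : RuleList → Set
  IsTRS R = All IsRewriteRule R

  _≐_ : RuleList → RuleList → Set
  A ≐ B = ∀ ρ → (ρ ∈ A) ⇔ (ρ ∈ B)

  _∪_ : RuleList → RuleList → RuleList
  A ∪ B = Data.List._++_ A B

  data _⟶[_]_ : Term → RuleList → Term → Set where
    root : ∀ {R l r} → (l , r) ∈ R → (σ : Subst) → (l ⟨ σ ⟩) ⟶[ R ] (r ⟨ σ ⟩)
    arg  : ∀ {R} f (ts : Vec Term (ar f)) (i : Fin (ar f)) u →
           lookup ts i ⟶[ R ] u → fun f ts ⟶[ R ] fun f (ts [ i ]≔ u)

  Step : RuleList → Term → Term → Set
  Step R s t = s ⟶[ R ] t

  _⟶*[_]_ : Term → RuleList → Term → Set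
  s ⟶*[ R ] t = Star (Step R) s t

  _↔*[_]_ : Term → RuleList → Term → Set
  s ↔*[ R ] t = EqClosure (Step R) s t

  Reversible : RuleList → Set
  Reversible P = ∀ s t → s ⟶[ P ] t → t ⟶*[ P ] s

  Confluent : RuleList → Set
  Confluent R = ∀ s t u → s ⟶*[ R ] t → s ⟶*[ R ] u →
                ∃[ v ] (t ⟶*[ R ] v × u ⟶*[ R ] v)

  Config : Set
  Config = RuleList × RuleList

  data _⇝_ : Config → Config → Set where
    partition : ∀ {S P S' P'} →
      (S ∪ P) ≐ (S' ∪ P') → Reversible P' → (S , P) ⇝ (S' , P')
    replacement : ∀ {S₀ S₁ P} (S : RuleList) (l r r' : Term) →
      S₀ ≐ (S ∪ ((l , r) ∷ [])) → S₁ ≐ (S ∪ ((l , r') ∷ [])) →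
      r ↔*[ P ] r' → IsRewriteRule (l , r') → (S₀ , P) ⇝ (S₁ , P)
    addition : ∀ {S S₁ P} (l r : Term) →
      S₁ ≐ (S ∪ ((l , r) ∷ [])) →
      (∃[ m ] (l ↔*[ P ] m × m ⟶*[ S ] r)) → IsRewriteRule (l , r) →
      (S , P) ⇝ (S₁ , P)

  _⇝*_ : Config → Config → Set
  _⇝*_ = Star _⇝_

module Submission where

-- Write A ⊑ B when every rule l → r of A is derivable in B,
-- i.e. l →*_B r.  Since rewriting is closed under substitutions and
-- contexts, A ⊑ B gives →*_A ⊆ →*_B; so two TRSs with A ⊑ B ⊑ A (written
-- A ≋ B) have the same many-step reduction, and confluence transfers
-- between them.  The heart of the proof is that every completion step
-- ⟨S, P⟩ ⇝ ⟨S', P'⟩ preserves reversibility of P and satisfies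
-- S ∪ P ≋ S' ∪ P': for Partition the rule sets coincide, and for
-- Replacement and Addition the conversions r ↔*_P r' (resp. l ↔*_P m)
-- are turned into reductions by reversibility of P.  Hence along the
-- derivation R ≋ R ∪ ∅ ≋ Sₙ ∪ Pₙ, and confluence of Sₙ ∪ Pₙ yields
-- confluence of R.

open import Defs
open import Data.Nat using (ℕ)
open import Data.List using ([]; _∷_)
open import Data.List.Properties using (++-identityʳ)
open import Data.List.Membership.Propositional using (_∈_)
open import Data.List.Membership.Propositional.Properties using (∈-++⁻)
open import Data.List.Relation.Unary.Any using (here)
open import Data.List.Relation.Binary.Subset.Propositional using (_⊆_)
open import Data.List.Relation.Binary.Subset.Propositional.Properties
  using (⊆-reflexive; xs⊆xs++ys; xs⊆ys++xs; ++⁺ˡ)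
open import Data.Product using (_×_; _,_; ∃-syntax)
open import Data.Sum using (inj₁; inj₂)
open import Data.Vec using (Vec; []; _∷_; lookup; _[_]≔_)
open import Data.Vec.Properties using (lookup∘update; []≔-idempotent; []≔-lookup)
open import Data.Fin using (zero; suc)
open import Data.Empty using (⊥; ⊥-elim)
open import Relation.Binary.PropositionalEquality
  using (_≡_; refl; sym; cong; cong₂; subst; subst₂)
open import Relation.Binary.Construct.Closure.ReflexiveTransitive
  using (ε; _◅_; _◅◅_)
open import Relation.Binary.Construct.Closure.Symmetric using (fwd; bwd)
import Relation.Binary.Construct.Closure.Equivalence as EqClosure
open import Function.Bundles using (Equivalence)

module Completion (F : Set) (ar : F → ℕ) (V : Set) where
  open TRS F ar V

  _⨾_ : Subst → Subst → Subst
  (τ ⨾ σ) x = τ x ⟨ σ ⟩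

  mutual
    ⟨⟩-⨾ : ∀ t τ σ → (t ⟨ τ ⟩) ⟨ σ ⟩ ≡ t ⟨ τ ⨾ σ ⟩
    ⟨⟩-⨾ (var x)    τ σ = refl
    ⟨⟩-⨾ (fun f ts) τ σ = cong (fun f) (⟨⟩*-⨾ ts τ σ)

    ⟨⟩*-⨾ : ∀ {n} (ts : Vec Term n) τ σ → (ts ⟨ τ ⟩*) ⟨ σ ⟩* ≡ ts ⟨ τ ⨾ σ ⟩*
    ⟨⟩*-⨾ []       τ σ = refl
    ⟨⟩*-⨾ (t ∷ ts) τ σ = cong₂ _∷_ (⟨⟩-⨾ t τ σ) (⟨⟩*-⨾ ts τ σ)

  mutual
    ⟨var⟩ : ∀ t → t ⟨ var ⟩ ≡ t
    ⟨var⟩ (var x)    = refl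
    ⟨var⟩ (fun f ts) = cong (fun f) (⟨var⟩* ts)

    ⟨var⟩* : ∀ {n} (ts : Vec Term n) → ts ⟨ var ⟩* ≡ ts
    ⟨var⟩* []       = refl
    ⟨var⟩* (t ∷ ts) = cong₂ _∷_ (⟨var⟩ t) (⟨var⟩* ts)

  lookup-⟨⟩* : ∀ {n} (ts : Vec Term n) i σ → lookup (ts ⟨ σ ⟩*) i ≡ lookup ts i ⟨ σ ⟩
  lookup-⟨⟩* (t ∷ ts) zero    σ = refl
  lookup-⟨⟩* (t ∷ ts) (suc i) σ = lookup-⟨⟩* ts i σ

  update-⟨⟩* : ∀ {n} (ts : Vec Term n) i u σ →
               (ts [ i ]≔ u) ⟨ σ ⟩* ≡ (ts ⟨ σ ⟩*) [ i ]≔ (u ⟨ σ ⟩)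
  update-⟨⟩* (t ∷ ts) zero    u σ = refl
  update-⟨⟩* (t ∷ ts) (suc i) u σ = cong (t ⟨ σ ⟩ ∷_) (update-⟨⟩* ts i u σ)

  arg′ : ∀ {B} f (ts : Vec Term (ar f)) i {a u} → lookup ts i ≡ a → a ⟶[ B ] u →
         fun f ts ⟶[ B ] fun f (ts [ i ]≔ u)
  arg′ f ts i refl step = arg f ts i _ step

  rule-step : ∀ {B l r} → (l , r) ∈ B → l ⟶[ B ] r
  rule-step {l = l} {r} l→r = subst₂ (Step _) (⟨var⟩ l) (⟨var⟩ r) (root l→r var)

  step-⟨⟩ : ∀ {B s t} σ → s ⟶[ B ] t → (s ⟨ σ ⟩) ⟶[ B ] (t ⟨ σ ⟩)
  step-⟨⟩ σ (root {l = l} {r} l→r τ) =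
    subst₂ (Step _) (sym (⟨⟩-⨾ l τ σ)) (sym (⟨⟩-⨾ r τ σ)) (root l→r (τ ⨾ σ))
  step-⟨⟩ σ (arg f ts i u step) =
    subst (λ us → fun f (ts ⟨ σ ⟩*) ⟶[ _ ] fun f us) (sym (update-⟨⟩* ts i u σ))
      (arg′ f (ts ⟨ σ ⟩*) i (lookup-⟨⟩* ts i σ) (step-⟨⟩ σ step))

  steps-⟨⟩ : ∀ {B s t} σ → s ⟶*[ B ] t → (s ⟨ σ ⟩) ⟶*[ B ] (t ⟨ σ ⟩)
  steps-⟨⟩ σ ε          = ε
  steps-⟨⟩ σ (st ◅ sts) = step-⟨⟩ σ st ◅ steps-⟨⟩ σ sts

  steps-arg : ∀ {B} f (ts : Vec Term (ar f)) i {a u} → a ⟶*[ B ] u →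
              fun f (ts [ i ]≔ a) ⟶*[ B ] fun f (ts [ i ]≔ u)
  steps-arg f ts i ε = ε
  steps-arg f ts i {a} (st ◅ sts) =
    subst (λ us → fun f (ts [ i ]≔ a) ⟶[ _ ] fun f us) ([]≔-idempotent ts i)
      (arg′ f (ts [ i ]≔ a) i (lookup∘update i ts a) st)
    ◅ steps-arg f ts i sts

  _⊑_ : RuleList → RuleList → Set
  A ⊑ B = ∀ {l r} → (l , r) ∈ A → l ⟶*[ B ] r

  _≋_ : RuleList → RuleList → Set
  A ≋ B = A ⊑ B × B ⊑ A

  ⊑-step : ∀ {A B s t} → A ⊑ B → s ⟶[ A ] t → s ⟶*[ B ] t
  ⊑-step A⊑B (root l→r σ) = steps-⟨⟩ σ (A⊑B l→r)
  ⊑-step A⊑B (arg f ts i u step) =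
    subst (λ us → fun f us ⟶*[ _ ] fun f (ts [ i ]≔ u)) ([]≔-lookup ts i)
      (steps-arg f ts i (⊑-step A⊑B step))

  ⊑-steps : ∀ {A B s t} → A ⊑ B → s ⟶*[ A ] t → s ⟶*[ B ] t
  ⊑-steps A⊑B ε          = ε
  ⊑-steps A⊑B (st ◅ sts) = ⊑-step A⊑B st ◅◅ ⊑-steps A⊑B sts

  ⊆⇒⊑ : ∀ {A B} → A ⊆ B → A ⊑ B
  ⊆⇒⊑ A⊆B l→r = rule-step (A⊆B l→r) ◅ ε

  ⊑-trans : ∀ {A B C} → A ⊑ B → B ⊑ C → A ⊑ C
  ⊑-trans A⊑B B⊑C l→r = ⊑-steps B⊑C (A⊑B l→r)

  ⊑-∪ : ∀ {A₁ A₂ B} → A₁ ⊑ B → A₂ ⊑ B → (A₁ ∪ A₂) ⊑ B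
  ⊑-∪ {A₁} A₁⊑B A₂⊑B l→r with ∈-++⁻ A₁ l→r
  ... | inj₁ ∈A₁ = A₁⊑B ∈A₁
  ... | inj₂ ∈A₂ = A₂⊑B ∈A₂

  ⊑-rule : ∀ {l r B} → l ⟶*[ B ] r → ((l , r) ∷ []) ⊑ B
  ⊑-rule l→*r (here refl) = l→*r

  ≋-refl : ∀ {A} → A ≋ A
  ≋-refl = ⊆⇒⊑ (λ ∈A → ∈A) , ⊆⇒⊑ (λ ∈A → ∈A)

  ≋-trans : ∀ {A B C} → A ≋ B → B ≋ C → A ≋ C
  ≋-trans (A⊑B , B⊑A) (B⊑C , C⊑B) = ⊑-trans A⊑B B⊑C , ⊑-trans C⊑B B⊑A

  ≐-⊆ : ∀ {A B} → A ≐ B → A ⊆ B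
  ≐-⊆ A≐B = Equivalence.to (A≐B _)

  ≐-⊇ : ∀ {A B} → A ≐ B → B ⊆ A
  ≐-⊇ A≐B = Equivalence.from (A≐B _)

  ≐⇒≋ : ∀ {A B} → A ≐ B → A ≋ B
  ≐⇒≋ A≐B = ⊆⇒⊑ (≐-⊆ A≐B) , ⊆⇒⊑ (≐-⊇ A≐B)

  ≋-confluent : ∀ {A B} → A ≋ B → Confluent B → Confluent A
  ≋-confluent (A⊑B , B⊑A) confB s t u s→*t s→*u
    with confB s t u (⊑-steps A⊑B s→*t) (⊑-steps A⊑B s→*u)
  ... | v , t→*v , u→*v = v , ⊑-steps B⊑A t→*v , ⊑-steps B⊑A u→*v

  reversible-conversion : ∀ {P s t} → Reversible P → s ↔*[ P ] t → s ⟶*[ P ] t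
  reversible-conversion rev ε              = ε
  reversible-conversion rev (fwd st ◅ sts) = st ◅ reversible-conversion rev sts
  reversible-conversion rev (bwd st ◅ sts) = rev _ _ st ◅◅ reversible-conversion rev sts

  ∅-reversible : Reversible []
  ∅-reversible s t st = ⊥-elim (no-∅-step st)
    where
    no-∅-step : ∀ {s t} → s ⟶[ [] ] t → ⊥
    no-∅-step (root () σ)
    no-∅-step (arg f ts i u st) = no-∅-step st

  replace-⊑ : ∀ {P} S l r r' → Reversible P → r' ↔*[ P ] r →
              ((S ∪ ((l , r) ∷ [])) ∪ P) ⊑ ((S ∪ ((l , r') ∷ [])) ∪ P)
  replace-⊑ {P} S l r r' rev r'↔r =
    ⊑-∪ (⊑-∪ (⊆⇒⊑ (λ ∈S → xs⊆xs++ys _ P (xs⊆xs++ys S _ ∈S)))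
             (⊑-rule (l→r' ◅ ⊑-steps (⊆⇒⊑ (xs⊆ys++xs P _))
                                      (reversible-conversion rev r'↔r))))
        (⊆⇒⊑ (xs⊆ys++xs P _))
    where
    l→r' : l ⟶[ (S ∪ ((l , r') ∷ [])) ∪ P ] r'
    l→r' = rule-step (xs⊆xs++ys _ P (xs⊆ys++xs _ S (here refl)))

  add-⊑ : ∀ {P} S l r → Reversible P → ∃[ m ] (l ↔*[ P ] m × m ⟶*[ S ] r) →
          ((S ∪ ((l , r) ∷ [])) ∪ P) ⊑ (S ∪ P)
  add-⊑ {P} S l r rev (m , l↔m , m→*r) =
    ⊑-∪ (⊑-∪ (⊆⇒⊑ (xs⊆xs++ys S P))
             (⊑-rule (⊑-steps (⊆⇒⊑ (xs⊆ys++xs P S)) (reversible-conversion rev l↔m)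
                      ◅◅ ⊑-steps (⊆⇒⊑ (xs⊆xs++ys S P)) m→*r)))
        (⊆⇒⊑ (xs⊆ys++xs P S))

  -- Replacement is symmetric in r, r'
  -- (up to symmetry of ↔*_P), so replace-⊑ is used in both directions, each
  -- time transported along the set equalities for S₀ and S₁.
  step-≋ : ∀ {S P S' P'} → (S , P) ⇝ (S' , P') → Reversible P →
           Reversible P' × (S ∪ P) ≋ (S' ∪ P')
  step-≋ (partition S∪P≐S'∪P' rev') rev = rev' , ≐⇒≋ S∪P≐S'∪P'
  step-≋ {S₀} {P} {S₁} (replacement S l r r' S₀≐ S₁≐ r↔r' _) rev =
    rev ,
    ⊑-trans (⊆⇒⊑ (++⁺ˡ P (≐-⊆ S₀≐)))
      (⊑-trans (replace-⊑ S l r r' rev (EqClosure.symmetric _ r↔r'))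
               (⊆⇒⊑ (++⁺ˡ P (≐-⊇ S₁≐)))) ,
    ⊑-trans (⊆⇒⊑ (++⁺ˡ P (≐-⊆ S₁≐)))
      (⊑-trans (replace-⊑ S l r' r rev r↔r') (⊆⇒⊑ (++⁺ˡ P (≐-⊇ S₀≐))))
  step-≋ {S} {P} {S₁} (addition l r S₁≐ l↔∘→*r _) rev =
    rev ,
    ⊆⇒⊑ (++⁺ˡ P (λ ∈S → ≐-⊇ S₁≐ (xs⊆xs++ys S _ ∈S))) ,
    ⊑-trans (⊆⇒⊑ (++⁺ˡ P (≐-⊆ S₁≐))) (add-⊑ S l r rev l↔∘→*r)

  derivation-≋ : ∀ {S P S' P'} → (S , P) ⇝* (S' , P') → Reversible P →
                 (S ∪ P) ≋ (S' ∪ P')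
  derivation-≋ ε rev = ≋-refl
  derivation-≋ (st ◅ sts) rev with step-≋ st rev
  ... | rev' , ≋₁ = ≋-trans ≋₁ (derivation-≋ sts rev')

  R≋R∪∅ : ∀ R → R ≋ (R ∪ [])
  R≋R∪∅ R = ⊆⇒⊑ (⊆-reflexive (sym (++-identityʳ R))) ,
            ⊆⇒⊑ (⊆-reflexive (++-identityʳ R))

theorem4p5 : (F : Set) (ar : F → ℕ) (V : Set) →
    let open TRS F ar V in
    (R Sₙ Pₙ : RuleList) → IsTRS R →
    (R , []) ⇝* (Sₙ , Pₙ) →
    Confluent (Sₙ ∪ Pₙ) → Confluent R
theorem4p5 F ar V R Sₙ Pₙ _ derivation =
  ≋-confluent (≋-trans (R≋R∪∅ R) (derivation-≋ derivation ∅-reversible))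
  where open Completion F ar V
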